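{- Let $a$ be an odd integer greater than $2$. Then $G_{2,a}=4a-2$.
   Context: For coprime positive integers $a_1,a_2$, $G_{a_1,a_2}$ denotes the least integer such that every integer $n>G_{a_1,a_2}$ can be written as $n=a_1x_1+a_2x_2$ with $x_1,x_2\in\mathbb{Z}_{\ge0}$ and $\gcd(x_1,x_2)=1$. -}

module Defs where

open import Data.Nat using (ℕ; _*_; _+_; _<_)
open import Data.Nat.GCD using (gcd)
open import Data.Integer as ℤ using (ℤ; +_)
open import Data.Product using (Σ; _×_; ∃₂)
open import Relation.Binary.PropositionalEquality using (_≡_)

-- n is representable as a₁x₁ + a₂x₂ with x₁,x₂ ∈ ℤ≥0 and gcd(x₁,x₂) = 1.
-- Representations only exist for nonnegative n, so n is an integer here.
CoprimeRep : ℕ → ℕ → ℤ → Set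
CoprimeRep a₁ a₂ n = ∃₂ λ (x₁ x₂ : ℕ) → (n ≡ + (a₁ * x₁ + a₂ * x₂)) × (gcd x₁ x₂ ≡ 1)

AllAbove : ℕ → ℕ → ℤ → Set
AllAbove a₁ a₂ G = ∀ (n : ℤ) → G ℤ.< n → CoprimeRep a₁ a₂ n

IsG : ℕ → ℕ → ℤ → Set
IsG a₁ a₂ G = AllAbove a₁ a₂ G × (∀ (H : ℤ) → AllAbove a₁ a₂ H → G ℤ.≤ H)

-- Write a = 3 + 2c, so 4a − 2 = 10 + 8c. Every n > 4a − 2 is 2x + a·y with gcd(x, y) = 1 for
-- some y ∈ {1, 2, 4}, chosen by n mod 4: odd n takes y = 1, and for even n exactly one of
-- (n − 2a)/2, (n − 4a)/2 is odd, which makes it coprime to y = 2 resp. y = 4. For 4a − 2 itself,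
-- y ≥ 4 is too large, odd y gives the wrong parity, y = 0 forces x = 2a − 1 ≠ 1, and y = 2
-- forces x = a − 1, which is even.
module Submission where

open import Defs
open import Data.Nat using (ℕ; zero; suc; _+_; _*_; _∸_; _^_; _<_; s≤s)
open import Data.Nat.Divisibility using (_∤_)
open import Data.Integer using (+_)

open import Data.Nat.Properties using (m+[n∸m]≡n; m+n∸m≡n; even≢odd; m≢1+m+n; *-cancelˡ-≡; +-cancelʳ-≡)
open import Data.Nat.DivMod using (result; _divMod_)
open import Data.Nat.Divisibility using (divides; ∣-trans; ∣-refl; _∣0)
open import Data.Nat.GCD using (gcd-zeroʳ)
open import Data.Nat.Coprimality as Coprimality
  using (Coprime; coprime⇒gcd≡1; gcd≡1⇒coprime; 1-coprimeTo; coprime-+; coprime-divisor)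
open import Data.Integer as ℤ using (+<+)
open import Data.Integer.Properties as ℤ using (≰⇒>; +-injective)
open import Data.Fin using (zero; suc)
open import Data.Product using (_,_; ∃)
open import Relation.Nullary using (¬_; yes; no; contradiction)
open import Data.Empty using (⊥)
open import Relation.Binary.PropositionalEquality using (_≡_; _≢_; refl; sym; trans; cong; subst)
open import Data.Nat.Tactic.RingSolver using (solve-∀)

coprime-*ʳ : ∀ {m n o} → Coprime m n → Coprime m o → Coprime m (n * o)
coprime-*ʳ {n = n} m⊥n m⊥o {d} (d∣m , d∣n*o) = m⊥o (d∣m , coprime-divisor d⊥n d∣n*o)
  where
  d⊥n : Coprime d n
  d⊥n (e∣d , e∣n) = m⊥n (∣-trans e∣d d∣m , e∣n)

coprime-^ʳ : ∀ {m n} e → Coprime m n → Coprime m (n ^ e)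
coprime-^ʳ zero    m⊥n = Coprimality.sym (1-coprimeTo _)
coprime-^ʳ (suc e) m⊥n = coprime-*ʳ m⊥n (coprime-^ʳ e m⊥n)

odd⊥2 : ∀ k → Coprime (suc (2 * k)) 2
odd⊥2 zero    = 1-coprimeTo 2
odd⊥2 (suc k) = subst (λ n → Coprime n 2) (step k) (coprime-+ (odd⊥2 k))
  where
  step : ∀ k → 2 + suc (2 * k) ≡ suc (2 * suc k)
  step = solve-∀

isG-of-gap : ∀ a₁ a₂ g → (∀ r → CoprimeRep a₁ a₂ (+ (suc g + r))) → ¬ CoprimeRep a₁ a₂ (+ g) →
             IsG a₁ a₂ (+ g)
isG-of-gap a₁ a₂ g rep gap = above , least
  where
  above : AllAbove a₁ a₂ (+ g)
  above (+ n) (+<+ g<n) = subst (λ k → CoprimeRep a₁ a₂ (+ k)) (m+[n∸m]≡n g<n) (rep (n ∸ suc g))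

  least : ∀ H → AllAbove a₁ a₂ H → + g ℤ.≤ H
  least H all with + g ℤ.≤? H
  ... | yes g≤H = g≤H
  ... | no  g≰H = contradiction (all (+ g) (≰⇒> g≰H)) gap

rep-with-1 : ∀ a₁ a₂ {n} x → n ≡ a₁ * x + a₂ * 1 → CoprimeRep a₁ a₂ (+ n)
rep-with-1 _ _ x eq = x , 1 , cong +_ eq , gcd-zeroʳ x

rep-odd-with-2^ : ∀ a₁ a₂ {n} k e → n ≡ a₁ * suc (2 * k) + a₂ * 2 ^ e → CoprimeRep a₁ a₂ (+ n)
rep-odd-with-2^ _ _ k e eq = suc (2 * k) , 2 ^ e , cong +_ eq , coprime⇒gcd≡1 (coprime-^ʳ e (odd⊥2 k))

module _ (c : ℕ) where
  private
    a = 3 + 2 * c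

  rep-above-10+8c : ∀ r → CoprimeRep 2 a (+ (suc (10 + 8 * c) + r))
  rep-above-10+8c r with r divMod 4
  ... | result q zero          refl = rep-with-1 2 a (4 + 3 * c + 2 * q) (r≡0 c q)
    where r≡0 : ∀ c q → 11 + 8 * c + (0 + q * 4) ≡ 2 * (4 + 3 * c + 2 * q) + (3 + 2 * c) * 1
          r≡0 = solve-∀
  ... | result q (suc zero)    refl = rep-odd-with-2^ 2 a (1 + c + q) 1 (r≡1 c q)
    where r≡1 : ∀ c q → 11 + 8 * c + (1 + q * 4) ≡ 2 * suc (2 * (1 + c + q)) + (3 + 2 * c) * 2
          r≡1 = solve-∀
  ... | result q (suc (suc zero)) refl = rep-with-1 2 a (5 + 3 * c + 2 * q) (r≡2 c q)
    where r≡2 : ∀ c q → 11 + 8 * c + (2 + q * 4) ≡ 2 * (5 + 3 * c + 2 * q) + (3 + 2 * c) * 1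
          r≡2 = solve-∀
  ... | result q (suc (suc (suc zero))) refl = rep-odd-with-2^ 2 a q 2 (r≡3 c q)
    where r≡3 : ∀ c q → 11 + 8 * c + (3 + q * 4) ≡ 2 * suc (2 * q) + (3 + 2 * c) * 4
          r≡3 = solve-∀

  10+8c-unrepresentable : ¬ CoprimeRep 2 a (+ (10 + 8 * c))
  10+8c-unrepresentable (x , y , eq , gcd≡1) = excluded x y (+-injective eq) (gcd≡1⇒coprime gcd≡1)
    where
    10+8c≢odd : ∀ n → 10 + 8 * c ≢ suc (2 * n)
    10+8c≢odd n eq = even≢odd (5 + 4 * c) n (trans (even c) eq)
      where even : ∀ c → 2 * (5 + 4 * c) ≡ 10 + 8 * c
            even = solve-∀

    excluded : ∀ x y → 10 + 8 * c ≡ 2 * x + a * y → Coprime x y → ⊥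
    excluded x 0 eq x⊥0 with x⊥0 (∣-refl , x ∣0)
    ... | refl = contradiction (trans eq (r c)) λ ()
      where r : ∀ c → 2 * 1 + (3 + 2 * c) * 0 ≡ 2
            r = solve-∀
    excluded x 1 eq _ = 10+8c≢odd (1 + c + x) (trans eq (r c x))
      where r : ∀ c x → 2 * x + (3 + 2 * c) * 1 ≡ suc (2 * (1 + c + x))
            r = solve-∀
    excluded x 2 eq x⊥2 = contradiction (x⊥2 (divides (1 + c) x-even , ∣-refl)) λ ()
      where
      r : ∀ c → 10 + 8 * c ≡ 2 * ((1 + c) * 2) + (3 + 2 * c) * 2
      r = solve-∀
      x-even : x ≡ (1 + c) * 2
      x-even = *-cancelˡ-≡ x ((1 + c) * 2) 2 (+-cancelʳ-≡ (a * 2) (2 * x) _ (trans (sym eq) (r c)))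
    excluded x 3 eq _ = 10+8c≢odd (4 + 3 * c + x) (trans eq (r c x))
      where r : ∀ c x → 2 * x + (3 + 2 * c) * 3 ≡ suc (2 * (4 + 3 * c + x))
            r = solve-∀
    excluded x (suc (suc (suc (suc y)))) eq _ = m≢1+m+n (10 + 8 * c) (trans eq (r c x y))
      where r : ∀ c x y → 2 * x + (3 + 2 * c) * (4 + y) ≡ suc (10 + 8 * c + (1 + (2 * x + (3 + 2 * c) * y)))
            r = solve-∀

  isG-3+2c : IsG 2 a (+ (10 + 8 * c))
  isG-3+2c = isG-of-gap 2 a (10 + 8 * c) rep-above-10+8c 10+8c-unrepresentable

odd>2⇒≡3+2* : ∀ {a} → 2 < a → 2 ∤ a → ∃ λ c → a ≡ 3 + 2 * c
odd>2⇒≡3+2* {a} 2<a 2∤a with a divMod 2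
... | result q       zero       refl = contradiction (divides q refl) 2∤a
... | result zero    (suc zero) refl = contradiction 2<a λ { (s≤s ()) }
... | result (suc c) (suc zero) refl = c , odd c
  where odd : ∀ c → 1 + suc c * 2 ≡ 3 + 2 * c
        odd = solve-∀

theorem6 : ∀ (a : ℕ) → 2 < a → 2 ∤ a → IsG 2 a (+ (4 * a ∸ 2))
theorem6 a 2<a 2∤a with odd>2⇒≡3+2* 2<a 2∤a
... | c , refl = subst (λ g → IsG 2 (3 + 2 * c) (+ g)) (sym (4a∸2 c)) (isG-3+2c c)
  where
  4a∸2 : ∀ c → 4 * (3 + 2 * c) ∸ 2 ≡ 10 + 8 * c
  4a∸2 c = trans (cong (_∸ 2) (4a≡2+ c)) (m+n∸m≡n 2 (10 + 8 * c))
    where 4a≡2+ : ∀ c → 4 * (3 + 2 * c) ≡ 2 + (10 + 8 * c)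
          4a≡2+ = solve-∀
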